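{- There exists a sequence of graphs $(G_h)_{h\geq 1}$ such that $\mathrm{cont}(G_h)/\mathrm{lin}(G_h)\to\infty$ as $h\to\infty$.
   Context: All graphs are finite, simple, loopless and undirected; $N[x]$ denotes the closed neighbourhood of a vertex $x$. The (closed) contiguity $\mathrm{cont}(G)$ of a graph $G=(V,E)$ is the minimum $k$ such that there exists a linear order $\sigma$ on $V$ for which, for every vertex $x$, $N[x]$ is a union of at most $k$ intervals of $\sigma$. A closed $p$-line-model of $G$ is a tuple $(\sigma_1,\ldots,\sigma_p)$ of linear orders on $V$ such that for every $x\in V$ there exist intervals $I_i$ of $\sigma_i$ ($1\le i\le p$, possibly empty, not necessarily disjoint) with $N[x]=\bigcup_{i=1}^p I_i$; the (closed) linearity $\mathrm{lin}(G)$ is the minimum such $p$. -}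

module Defs where

open import Data.Nat using (ℕ; _≤_; _<_; _*_)
open import Data.Fin using (Fin; toℕ)
open import Data.Bool using (Bool; true)
open import Data.Product using (Σ; ∃; _×_; _,_)
open import Data.Sum using (_⊎_)
open import Data.Fin.Permutation using (Permutation′; _⟨$⟩ʳ_)
open import Function.Bundles using (_⇔_)
open import Relation.Binary.PropositionalEquality using (_≡_)
open import Relation.Nullary using (¬_)

record Graph : Set where
  field
    n      : ℕ
    adj    : Fin n → Fin n → Bool
    sym    : ∀ x y → adj x y ≡ adj y x
    irrefl : ∀ x → ¬ (adj x x ≡ true)
open Graph public

N[_]∋ : (G : Graph) → Fin (n G) → Fin (n G) → Set
N[ G ]∋ x y = (x ≡ y) ⊎ (adj G x y ≡ true)

-- A linear order on Fin n is given by a permutation σ assigning to each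
-- vertex its position σ ⟨$⟩ʳ v.  An interval of σ is given by a pair
-- (a , b) and consists of the vertices with position p, a ≤ p < b
-- (empty when b ≤ a).
Interval : Set
Interval = ℕ × ℕ

InInterval : ∀ {m} → Permutation′ m → Interval → Fin m → Set
InInterval σ (a , b) v = (a ≤ toℕ (σ ⟨$⟩ʳ v)) × (toℕ (σ ⟨$⟩ʳ v) < b)

-- σ witnesses that every N[x] is a union of at most k intervals of σ
-- (k possibly-empty intervals).
ContModel : (G : Graph) → ℕ → Permutation′ (n G) → Set
ContModel G k σ =
  ∀ x → Σ (Fin k → Interval) λ I →
    ∀ y → N[ G ]∋ x y ⇔ (∃ λ (i : Fin k) → InInterval σ (I i) y)

HasCont : Graph → ℕ → Set
HasCont G k = ∃ λ (σ : Permutation′ (n G)) → ContModel G k σ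

IsCont : Graph → ℕ → Set
IsCont G k = HasCont G k × (∀ j → HasCont G j → k ≤ j)

LineModel : (G : Graph) → (p : ℕ) → (Fin p → Permutation′ (n G)) → Set
LineModel G p σ =
  ∀ x → Σ (Fin p → Interval) λ I →
    ∀ y → N[ G ]∋ x y ⇔ (∃ λ (i : Fin p) → InInterval (σ i) (I i) y)

HasLin : Graph → ℕ → Set
HasLin G p = ∃ λ (σ : Fin p → Permutation′ (n G)) → LineModel G p σ

IsLin : Graph → ℕ → Set
IsLin G p = HasLin G p × (∀ q → HasLin G q → p ≤ q)

module Submission where

-- Rook graphs have bounded linearity but unbounded contiguity.
--
-- The rook graph R_m has the m × m grid as vertex set, two cells being
-- adjacent when they share a row or a column.  Every closed neighbourhood is
-- a row block of the row-major order together with a column block of the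
-- column-major order, so lin(R_m) ≤ 2.
--
-- For the contiguity we count boundaries.  If N[x] is a union of k intervals
-- of an order σ, membership in N[x] changes at most 2k times between
-- consecutive positions of σ.  Summing over x, the consecutive pairs (u, v)
-- of σ are separated (|N[u] △ N[v]|) by at most 2k·N vertices in total,
-- whereas in R_m any two distinct cells are separated by at least m − 1
-- vertices.  Hence (N − 1)(m − 1) ≤ 2kN with N = m², so cont(R_m) grows
-- linearly in m.

open import Defs
open import Data.Bool using (Bool; true; false; not; _xor_)
open import Data.Bool.Properties using () renaming (_≟_ to _≟ᵇ_)
open import Data.Empty using (⊥-elim)
open import Data.Fin using (Fin; zero; suc; toℕ; fromℕ<; inject₁; _↑ˡ_; _↑ʳ_; combine; quotient; remainder)
open import Data.Fin.Properties using (toℕ-injective; toℕ-fromℕ<; toℕ<n; toℕ-inject₁; toℕ-combine; remQuot-combine; combine-remQuot; any?; all?) renaming (_≟_ to _≟ᶠ_)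
open import Data.Fin.Permutation using (Permutation′; _⟨$⟩ʳ_; _⟨$⟩ˡ_; inverseʳ; inverseˡ; permutation; id)
open import Data.Nat using (ℕ; zero; suc; _+_; _*_; _⊓_; _≤_; _<_; z≤n; s≤s; s≤s⁻¹; _≤?_; _<?_)
open import Data.Nat.Properties
open import Algebra.Properties.Semiring.Sum +-*-semiring using (sum; sum-syntax; sum-cong-≗; ∑-comm; ∑-distrib-+)
open import Data.Product using (Σ; ∃; _×_; _,_; proj₁; proj₂)
open import Data.Sum using (_⊎_; inj₁; inj₂)
open import Data.Vec using (Vec; []; _∷_; lookup; tabulate)
open import Data.Vec.Properties using (lookup∘tabulate)
open import Function using (_∘_)
open import Function.Bundles using (_⇔_; mk⇔; Equivalence)
import Function.Properties.Equivalence as ⇔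
open import Relation.Binary.Definitions using (tri<; tri≈; tri>)
open import Relation.Binary.PropositionalEquality as ≡ using (_≡_; _≢_; refl; cong; subst)
open import Relation.Nullary using (¬_; Dec; yes; no; does)
open import Relation.Nullary.Decidable using (map′; _×-dec_; _⊎-dec_; _→-dec_; ¬?; dec-true; dec-false)

open Equivalence using (to; from)

⟦_⟧ : Bool → ℕ
⟦ true ⟧ = 1
⟦ false ⟧ = 0

sum-mono : ∀ {k} {f g : Fin k → ℕ} → (∀ i → f i ≤ g i) → sum f ≤ sum g
sum-mono {zero} f≤g = z≤n
sum-mono {suc k} f≤g = +-mono-≤ (f≤g zero) (sum-mono (f≤g ∘ suc))

term≤sum : ∀ {k} (f : Fin k → ℕ) i → f i ≤ sum f
term≤sum f zero = m≤m+n _ _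
term≤sum f (suc i) = ≤-trans (term≤sum (f ∘ suc) i) (m≤n+m _ _)

sum-const : ∀ k c → ∑[ i < k ] c ≡ k * c
sum-const zero c = refl
sum-const (suc k) c = cong (c +_) (sum-const k c)

sum-split : ∀ a b (f : Fin (a + b) → ℕ) → sum f ≡ ∑[ i < a ] f (i ↑ˡ b) + ∑[ j < b ] f (a ↑ʳ j)
sum-split zero b f = refl
sum-split (suc a) b f = ≡.trans (cong (f zero +_) (sum-split a b (f ∘ suc))) (≡.sym (+-assoc (f zero) _ _))

sum-combine : ∀ m k (f : Fin (m * k) → ℕ) → sum f ≡ ∑[ r < m ] ∑[ c < k ] f (combine r c)
sum-combine zero k f = refl
sum-combine (suc m) k f =
  ≡.trans (sum-split k (m * k) f) (cong (∑[ c < k ] f (c ↑ˡ (m * k)) +_) (sum-combine m k (f ∘ (k ↑ʳ_))))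

at-most-one : ∀ k c → ∑[ i < k ] ⟦ does (toℕ i ≟ c) ⟧ ≤ 1
at-most-one zero c = z≤n
at-most-one (suc k) zero = ≤-reflexive (cong suc (≡.trans (sum-const k 0) (*-zeroʳ k)))
at-most-one (suc k) (suc c) = at-most-one k c

all-but-one : ∀ {m} (a : Fin m) → m ≤ suc (∑[ r < m ] ⟦ not (does (r ≟ᶠ a)) ⟧)
all-but-one {suc m} zero = s≤s (≤-reflexive (≡.sym (≡.trans (sum-const m 1) (*-identityʳ m))))
all-but-one {suc m} (suc a) = s≤s (all-but-one a)

xor-≤ : ∀ a b {n} → (a ≢ b → 1 ≤ n) → ⟦ a xor b ⟧ ≤ n
xor-≤ true true _ = z≤n
xor-≤ false false _ = z≤n
xor-≤ true false differ = differ λ ()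
xor-≤ false true differ = differ λ ()

∑-consecutive : (N : ℕ) → (Fin N → Fin N → ℕ) → ℕ
∑-consecutive zero f = 0
∑-consecutive (suc N) f = ∑[ p < N ] f (inject₁ p) (suc p)

inject₁≢suc : ∀ {N} (p : Fin N) → inject₁ p ≢ suc p
inject₁≢suc p e = 1+n≢n (≡.sym (≡.trans (≡.sym (toℕ-inject₁ p)) (cong toℕ e)))

∑-consecutive-lower : ∀ N D (f : Fin N → Fin N → ℕ) →
  (∀ p q → p ≢ q → D ≤ f p q) → N * D ≤ ∑-consecutive N f + D
∑-consecutive-lower zero D f distinct = z≤n
∑-consecutive-lower (suc N) D f distinct = begin
  D + N * D                  ≡⟨ +-comm D (N * D) ⟩
  N * D + D                  ≡⟨ cong (_+ D) (sum-const N D) ⟨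
  ∑[ p < N ] D + D           ≤⟨ +-monoˡ-≤ D (sum-mono λ p → distinct _ _ (inject₁≢suc p)) ⟩
  ∑-consecutive (suc N) f + D ∎
  where open ≤-Reasoning

∑-consecutive-∑ : ∀ N M (f : Fin M → Fin N → Fin N → ℕ) →
  ∑-consecutive N (λ p q → ∑[ x < M ] f x p q) ≡ ∑[ x < M ] ∑-consecutive N (f x)
∑-consecutive-∑ zero M f = ≡.sym (≡.trans (sum-const M 0) (*-zeroʳ M))
∑-consecutive-∑ (suc N) M f = ∑-comm (λ p x → f x (inject₁ p) (suc p))

-- Unions of intervals have few boundaries

InPos : Interval → ℕ → Set
InPos (a , b) q = a ≤ q × q < b

IsUnion : ∀ {N k} → (Fin N → Bool) → (Fin k → Interval) → Set
IsUnion S I = ∀ p → S p ≡ true ⇔ ∃ λ i → InPos (I i) (toℕ p)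

endpoints : ∀ {k} → (Fin k → Interval) → ℕ → ℕ
endpoints {k} I q = ∑[ i < k ] (⟦ does (q ≟ proj₁ (I i)) ⟧ + ⟦ does (q ≟ proj₂ (I i)) ⟧)

change⇒endpoint : ∀ {N k} {S : Fin N → Bool} {I : Fin k → Interval} → IsUnion S I →
  ∀ p q → toℕ q ≡ suc (toℕ p) → S p ≢ S q →
  ∃ λ i → toℕ q ≡ proj₁ (I i) ⊎ toℕ q ≡ proj₂ (I i)
change⇒endpoint {S = S} {I} union p q q≡p+1 S≢ with S p in Sp | S q in Sq
... | true | true = ⊥-elim (S≢ refl)
... | false | false = ⊥-elim (S≢ refl)
... | true | false = i , inj₂ (≤-antisym (≤-trans (≤-reflexive q≡p+1) p<b) (≮⇒≥ q∉I))
  where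
    p∈I = to (union p) Sp
    i = proj₁ p∈I
    a≤p : proj₁ (I i) ≤ toℕ p
    a≤p = proj₁ (proj₂ p∈I)
    p<b : toℕ p < proj₂ (I i)
    p<b = proj₂ (proj₂ p∈I)
    -- otherwise q would lie in the same interval as p
    q∉I : ¬ toℕ q < proj₂ (I i)
    q∉I q<b with () ← ≡.trans (≡.sym Sq) (from (union q) (i , ≤-trans a≤p (≤-trans (n≤1+n _) (≤-reflexive (≡.sym q≡p+1))) , q<b))
... | false | true = i , inj₁ (≤-antisym (≤-trans (≤-reflexive q≡p+1) (≰⇒> p∉I)) a≤q)
  where
    q∈I = to (union q) Sq
    i = proj₁ q∈I
    a≤q : proj₁ (I i) ≤ toℕ q
    a≤q = proj₁ (proj₂ q∈I)
    q<b : toℕ q < proj₂ (I i)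
    q<b = proj₂ (proj₂ q∈I)
    -- otherwise p would lie in the same interval as q
    p∉I : ¬ proj₁ (I i) ≤ toℕ p
    p∉I a≤p with () ← ≡.trans (≡.sym Sp) (from (union p) (i , a≤p , <-trans (≤-reflexive (≡.sym q≡p+1)) q<b))

boundaries-≤ : ∀ N {k} (S : Fin N → Bool) (I : Fin k → Interval) → IsUnion S I →
  ∑-consecutive N (λ p q → ⟦ S p xor S q ⟧) ≤ k * 2
boundaries-≤ zero S I union = z≤n
boundaries-≤ (suc N) {k} S I union = begin
  ∑[ p < N ] ⟦ S (inject₁ p) xor S (suc p) ⟧
    ≤⟨ sum-mono change≤endpoints ⟩
  ∑[ p < N ] endpoints I (suc (toℕ p))
    ≡⟨ ∑-comm {N} {k} (λ p i → ⟦ does (suc (toℕ p) ≟ proj₁ (I i)) ⟧ + ⟦ does (suc (toℕ p) ≟ proj₂ (I i)) ⟧) ⟩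
  ∑[ i < k ] ∑[ p < N ] (⟦ does (suc (toℕ p) ≟ proj₁ (I i)) ⟧ + ⟦ does (suc (toℕ p) ≟ proj₂ (I i)) ⟧)
    ≡⟨ sum-cong-≗ {k} (λ i → ∑-distrib-+ {N} (λ p → ⟦ does (suc (toℕ p) ≟ proj₁ (I i)) ⟧) (λ p → ⟦ does (suc (toℕ p) ≟ proj₂ (I i)) ⟧)) ⟩
  ∑[ i < k ] (∑[ p < N ] ⟦ does (suc (toℕ p) ≟ proj₁ (I i)) ⟧ + ∑[ p < N ] ⟦ does (suc (toℕ p) ≟ proj₂ (I i)) ⟧)
    ≤⟨ sum-mono (λ i → +-mono-≤ (one-after-0 (proj₁ (I i))) (one-after-0 (proj₂ (I i)))) ⟩
  ∑[ i < k ] 2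
    ≡⟨ sum-const k 2 ⟩
  k * 2 ∎
  where
    open ≤-Reasoning
    one-after-0 : ∀ c → ∑[ p < N ] ⟦ does (suc (toℕ p) ≟ c) ⟧ ≤ 1
    one-after-0 c = ≤-trans (m≤n+m _ _) (at-most-one (suc N) c)
    endpoint-counted : ∀ q → (∃ λ i → q ≡ proj₁ (I i) ⊎ q ≡ proj₂ (I i)) → 1 ≤ endpoints I q
    endpoint-counted q (i , inj₁ e) = ≤-trans (≤-trans (≤-reflexive (cong ⟦_⟧ (≡.sym (dec-true (q ≟ _) e)))) (m≤m+n _ _)) (term≤sum _ i)
    endpoint-counted q (i , inj₂ e) = ≤-trans (≤-trans (≤-reflexive (cong ⟦_⟧ (≡.sym (dec-true (q ≟ _) e)))) (m≤n+m _ _)) (term≤sum _ i)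
    change≤endpoints : ∀ p → ⟦ S (inject₁ p) xor S (suc p) ⟧ ≤ endpoints I (suc (toℕ p))
    change≤endpoints p = xor-≤ (S (inject₁ p)) (S (suc p))
      (endpoint-counted _ ∘ change⇒endpoint union (inject₁ p) (suc p) (cong suc (≡.sym (toℕ-inject₁ p))))

-- A lower bound on the contiguity of a graph

does⇔ : ∀ {P : Set} (P? : Dec P) → does P? ≡ true ⇔ P
does⇔ (yes p) = mk⇔ (λ _ → p) (λ _ → refl)
does⇔ (no ¬p) = mk⇔ (λ ()) (λ p → ⊥-elim (¬p p))

N? : (G : Graph) → ∀ x y → Dec (N[ G ]∋ x y)
N? G x y = (x ≟ᶠ y) ⊎-dec (adj G x y ≟ᵇ true)

inN : (G : Graph) → Fin (n G) → Fin (n G) → Bool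
inN G x y = does (N? G x y)

-- |N[u] △ N[v]|: the number of vertices whose closed neighbourhood contains
-- exactly one of u and v.
separation : (G : Graph) → Fin (n G) → Fin (n G) → ℕ
separation G u v = ∑[ x < n G ] ⟦ inN G x u xor inN G x v ⟧

-- If N[x] is a union of k intervals of σ for every x, the N − 1 consecutive
-- pairs of σ are separated by at most 2k·N vertices in total; so if distinct
-- vertices are always separated by D vertices, (N − 1)·D ≤ 2k·N.
cont-lower-bound : ∀ G k D → HasCont G k →
  (∀ u v → u ≢ v → D ≤ separation G u v) → n G * D ≤ n G * (k * 2) + D
cont-lower-bound G k D (σ , model) separated = begin
  N * D
    ≤⟨ ∑-consecutive-lower N D _ (λ p q p≢q → separated (vert p) (vert q) (p≢q ∘ vert-injective)) ⟩
  ∑-consecutive N (λ p q → separation G (vert p) (vert q)) + D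
    ≡⟨ cong (_+ D) (∑-consecutive-∑ N N (λ x p q → ⟦ S x p xor S x q ⟧)) ⟩
  ∑[ x < N ] ∑-consecutive N (λ p q → ⟦ S x p xor S x q ⟧) + D
    ≤⟨ +-monoˡ-≤ D (sum-mono λ x → boundaries-≤ N (S x) (proj₁ (model x)) (S-union x)) ⟩
  ∑[ x < N ] (k * 2) + D
    ≡⟨ cong (_+ D) (sum-const N (k * 2)) ⟩
  N * (k * 2) + D ∎
  where
    open ≤-Reasoning
    N = n G
    vert : Fin N → Fin N
    vert p = σ ⟨$⟩ˡ p
    vert-injective : ∀ {p q} → vert p ≡ vert q → p ≡ q
    vert-injective e = ≡.trans (≡.sym (inverseʳ σ)) (≡.trans (cong (σ ⟨$⟩ʳ_) e) (inverseʳ σ))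
    S : Fin N → Fin N → Bool
    S x p = inN G x (vert p)
    S-union : ∀ x → IsUnion (S x) (proj₁ (model x))
    S-union x p = subst (λ w → S x p ≡ true ⇔ ∃ λ i → InPos (proj₁ (model x) i) (toℕ w)) (inverseʳ σ)
                    (⇔.trans (does⇔ (N? G x (vert p))) (proj₂ (model x) (vert p)))

-- Rook graphs

block : ℕ → ∀ {k} → Fin k → Interval
block m r = m * toℕ r , m * toℕ r + m

block-step : ∀ m {r r'} → r < r' → m * r + m ≤ m * r'
block-step m {r} {r'} r<r' = begin
  m * r + m   ≡⟨ +-comm (m * r) m ⟩
  m + m * r   ≡⟨ *-suc m r ⟨
  m * suc r   ≤⟨ *-monoʳ-≤ m r<r' ⟩
  m * r'      ∎
  where open ≤-Reasoning

in-block⇔ : ∀ {k m} (r r' : Fin k) (c : Fin m) → InPos (block m r) (toℕ (combine r' c)) ⇔ r ≡ r'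
in-block⇔ {m = m} r r' c = subst (λ q → InPos (block m r) q ⇔ r ≡ r') (≡.sym (toℕ-combine r' c)) (mk⇔ same-row in-row)
  where
    c<m = toℕ<n c
    same-row : InPos (block m r) (m * toℕ r' + toℕ c) → r ≡ r'
    same-row (lo , hi) with <-cmp (toℕ r) (toℕ r')
    ... | tri≈ _ e _ = toℕ-injective e
    ... | tri< r<r' _ _ = ⊥-elim (<⇒≱ hi (≤-trans (block-step m r<r') (m≤m+n _ _)))
    ... | tri> _ _ r'<r = ⊥-elim (<⇒≱ (<-≤-trans (+-monoʳ-< (m * toℕ r') c<m) (block-step m r'<r)) lo)
    in-row : r ≡ r' → InPos (block m r) (m * toℕ r' + toℕ c)
    in-row refl = m≤m+n _ _ , +-monoʳ-< (m * toℕ r) c<m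

does-cong : ∀ {P Q : Set} → P ⇔ Q → (P? : Dec P) (Q? : Dec Q) → does P? ≡ does Q?
does-cong P⇔Q (yes p) (yes q) = refl
does-cong P⇔Q (no ¬p) (no ¬q) = refl
does-cong P⇔Q (yes p) (no ¬q) = ⊥-elim (¬q (to P⇔Q p))
does-cong P⇔Q (no ¬p) (yes q) = ⊥-elim (¬p (from P⇔Q q))

module _ (m : ℕ) where

  row col : Fin (m * m) → Fin m
  row = quotient m
  col = remainder {m} m

  row-combine : ∀ r c → row (combine r c) ≡ r
  row-combine r c = cong proj₁ (remQuot-combine {m} {m} r c)

  col-combine : ∀ r c → col (combine r c) ≡ c
  col-combine r c = cong proj₂ (remQuot-combine {m} {m} r c)

  cell-≡ : ∀ {x y} → row x ≡ row y → col x ≡ col y → x ≡ y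
  cell-≡ {x} {y} r≡ c≡ =
    ≡.trans (≡.sym (combine-remQuot {m} m x)) (≡.trans (≡.cong₂ combine r≡ c≡) (combine-remQuot {m} m y))

  SameLine : Fin (m * m) → Fin (m * m) → Set
  SameLine x y = row x ≡ row y ⊎ col x ≡ col y

  RookAdj : Fin (m * m) → Fin (m * m) → Set
  RookAdj x y = x ≢ y × SameLine x y

  rookAdj? : ∀ x y → Dec (RookAdj x y)
  rookAdj? x y = ¬? (x ≟ᶠ y) ×-dec ((row x ≟ᶠ row y) ⊎-dec (col x ≟ᶠ col y))

  rookAdj-sym : ∀ x y → RookAdj x y → RookAdj y x
  rookAdj-sym x y (x≢y , inj₁ e) = x≢y ∘ ≡.sym , inj₁ (≡.sym e)
  rookAdj-sym x y (x≢y , inj₂ e) = x≢y ∘ ≡.sym , inj₂ (≡.sym e)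

  Rook : Graph
  Rook = record
    { n = m * m
    ; adj = λ x y → does (rookAdj? x y)
    ; sym = λ x y → does-cong (mk⇔ (rookAdj-sym x y) (rookAdj-sym y x)) (rookAdj? x y) (rookAdj? y x)
    ; irrefl = λ x a → proj₁ (to (does⇔ (rookAdj? x x)) a) refl
    }

  rook-closed : ∀ x y → N[ Rook ]∋ x y ⇔ SameLine x y
  rook-closed x y = mk⇔ line adjacent
    where
      line : N[ Rook ]∋ x y → SameLine x y
      line (inj₁ refl) = inj₁ refl
      line (inj₂ a) = proj₂ (to (does⇔ (rookAdj? x y)) a)
      adjacent : SameLine x y → N[ Rook ]∋ x y
      adjacent l = by-cases (x ≟ᶠ y)
        where
          by-cases : Dec (x ≡ y) → N[ Rook ]∋ x y
          by-cases (yes x≡y) = inj₁ x≡y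
          by-cases (no x≢y) = inj₂ (from (does⇔ (rookAdj? x y)) (x≢y , l))

  line-separation : ∀ u v (cell : Fin m → Fin (m * m)) (a : Fin m) →
    (∀ r → r ≢ a → N[ Rook ]∋ (cell r) u × ¬ N[ Rook ]∋ (cell r) v) →
    m ≤ suc (∑[ r < m ] ⟦ inN Rook (cell r) u xor inN Rook (cell r) v ⟧)
  line-separation u v cell a separates = ≤-trans (all-but-one a) (s≤s (sum-mono counted))
    where
      counted : ∀ r → ⟦ not (does (r ≟ᶠ a)) ⟧ ≤ ⟦ inN Rook (cell r) u xor inN Rook (cell r) v ⟧
      counted r with r ≟ᶠ a
      ... | yes _ = z≤n
      ... | no r≢a with separates r r≢a
      ...   | in-u , not-in-v
              rewrite dec-true (N? Rook (cell r) u) in-u | dec-false (N? Rook (cell r) v) not-in-v = ≤-refl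

  separation-by-rows : ∀ u v →
    separation Rook u v ≡ ∑[ r < m ] ∑[ c < m ] ⟦ inN Rook (combine r c) u xor inN Rook (combine r c) v ⟧
  separation-by-rows u v = sum-combine m m (λ x → ⟦ inN Rook x u xor inN Rook x v ⟧)

  -- Distinct cells are separated by at least m − 1 vertices: by the column
  -- of u if u and v lie in different columns, otherwise by the row of u.
  rook-separation : ∀ u v → u ≢ v → m ≤ suc (separation Rook u v)
  rook-separation u v u≢v with col u ≟ᶠ col v
  ... | no cols≢ = ≤-trans (line-separation u v (λ r → combine r (col u)) (row v) in-column)
                     (s≤s (≤-trans (sum-mono {m} λ r → term≤sum {m} (f r) (col u))
                                   (≤-reflexive (≡.sym (separation-by-rows u v)))))
    where
      f : Fin m → Fin m → ℕ
      f r c = ⟦ inN Rook (combine r c) u xor inN Rook (combine r c) v ⟧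
      in-column : ∀ r → r ≢ row v → N[ Rook ]∋ (combine r (col u)) u × ¬ N[ Rook ]∋ (combine r (col u)) v
      in-column r r≢ = from (rook-closed (combine r (col u)) u) (inj₂ (col-combine r (col u)))
                     , avoids ∘ to (rook-closed (combine r (col u)) v)
        where
          avoids : ¬ SameLine (combine r (col u)) v
          avoids (inj₁ e) = r≢ (≡.trans (≡.sym (row-combine r (col u))) e)
          avoids (inj₂ e) = cols≢ (≡.trans (≡.sym (col-combine r (col u))) e)
  ... | yes cols≡ = ≤-trans (line-separation u v (combine (row u)) (col v) in-row)
                      (s≤s (≤-trans (term≤sum {m} (λ r → ∑[ c < m ] f r c) (row u))
                                    (≤-reflexive (≡.sym (separation-by-rows u v)))))
    where
      f : Fin m → Fin m → ℕ
      f r c = ⟦ inN Rook (combine r c) u xor inN Rook (combine r c) v ⟧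
      in-row : ∀ c → c ≢ col v → N[ Rook ]∋ (combine (row u) c) u × ¬ N[ Rook ]∋ (combine (row u) c) v
      in-row c c≢ = from (rook-closed (combine (row u) c) u) (inj₁ (row-combine (row u) c))
                  , avoids ∘ to (rook-closed (combine (row u) c) v)
        where
          avoids : ¬ SameLine (combine (row u) c) v
          avoids (inj₁ e) = u≢v (cell-≡ (≡.trans (≡.sym (row-combine (row u) c)) e) cols≡)
          avoids (inj₂ e) = c≢ (≡.trans (≡.sym (col-combine (row u) c)) e)

  transpose : Fin (m * m) → Fin (m * m)
  transpose x = combine (col x) (row x)

  transpose-involutive : ∀ x → transpose (transpose x) ≡ x
  transpose-involutive x = cell-≡ (≡.trans (row-combine _ _) (col-combine (col x) (row x)))
                                 (≡.trans (col-combine _ _) (row-combine (col x) (row x)))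

  rook-orders : Fin 2 → Permutation′ (m * m)
  rook-orders zero = id
  rook-orders (suc zero) = permutation transpose transpose transpose-involutive transpose-involutive

  in-row-block⇔ : ∀ r y → InPos (block m r) (toℕ y) ⇔ r ≡ row y
  in-row-block⇔ r y = subst (λ z → InPos (block m r) (toℕ z) ⇔ r ≡ row y) (combine-remQuot {m} m y)
                        (in-block⇔ r (row y) (col y))

  in-column-block⇔ : ∀ c y → InPos (block m c) (toℕ (transpose y)) ⇔ c ≡ col y
  in-column-block⇔ c y = in-block⇔ c (col y) (row y)

  -- N[x] is the row block of x in the row-major order together with the
  -- column block of x in the column-major order.
  rook-line-model : LineModel Rook 2 rook-orders
  rook-line-model x = lines , λ y → ⇔.trans (rook-closed x y) (mk⇔ (on-line y) (off-line y))
    where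
      lines : Fin 2 → Interval
      lines zero = block m (row x)
      lines (suc zero) = block m (col x)
      on-line : ∀ y → SameLine x y → ∃ λ i → InInterval (rook-orders i) (lines i) y
      on-line y (inj₁ e) = zero , from (in-row-block⇔ (row x) y) e
      on-line y (inj₂ e) = suc zero , from (in-column-block⇔ (col x) y) e
      off-line : ∀ y → (∃ λ i → InInterval (rook-orders i) (lines i) y) → SameLine x y
      off-line y (zero , p) = inj₁ (to (in-row-block⇔ (row x) y) p)
      off-line y (suc zero , p) = inj₂ (to (in-column-block⇔ (col x) y) p)

-- Having a k-contiguity or a p-line model is decidable

Searchable : Set → Set₁
Searchable A = ∀ (P : A → Set) → (∀ a → Dec (P a)) → Dec (∃ P)

search-Fin : ∀ {k} → Searchable (Fin k)
search-Fin P P? = any? P?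

search-× : ∀ {A B} → Searchable A → Searchable B → Searchable (A × B)
search-× search-A search-B P P? =
  map′ (λ (a , b , p) → (a , b) , p) (λ ((a , b) , p) → a , b , p)
       (search-A (λ a → ∃ λ b → P (a , b)) (λ a → search-B (λ b → P (a , b)) (λ b → P? (a , b))))

search-Vec : ∀ {A} → Searchable A → ∀ k → Searchable (Vec A k)
search-Vec search-A zero P P? = map′ ([] ,_) (λ { ([] , p) → p }) (P? [])
search-Vec search-A (suc k) P P? =
  map′ (λ (a , as , p) → a ∷ as , p) (λ { (a ∷ as , p) → a , as , p })
       (search-A (λ a → ∃ λ as → P (a ∷ as)) (λ a → search-Vec search-A k (λ as → P (a ∷ as)) (λ as → P? (a ∷ as))))

⇔-dec : ∀ {A B : Set} → Dec A → Dec B → Dec (A ⇔ B)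
⇔-dec A? B? = map′ (λ (f , g) → mk⇔ f g) (λ e → to e , from e) ((A? →-dec B?) ×-dec (B? →-dec A?))

∃-⇔ : ∀ {I : Set} {A B : I → Set} → (∀ i → A i ⇔ B i) → ∃ A ⇔ ∃ B
∃-⇔ A⇔B = mk⇔ (λ (i , a) → i , to (A⇔B i) a) (λ (i , b) → i , from (A⇔B i) b)

InPos? : ∀ J q → Dec (InPos J q)
InPos? (a , b) q = (a ≤? q) ×-dec (q <? b)

-- Models described through the position maps τ i = σ i ⟨$⟩ʳ_ of the orders:
-- the intervals I cover N[x] …
Covers : (G : Graph) {p : ℕ} → (Fin p → Fin (n G) → Fin (n G)) → Fin (n G) → (Fin p → Interval) → Set
Covers G τ x I = ∀ y → N[ G ]∋ x y ⇔ ∃ λ i → InPos (I i) (toℕ (τ i y))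

-- … and every N[x] is covered.  LineModel G p σ is PosModel G p (λ i → σ i ⟨$⟩ʳ_).
PosModel : (G : Graph) (p : ℕ) → (Fin p → Fin (n G) → Fin (n G)) → Set
PosModel G p τ = ∀ x → ∃ (Covers G τ x)

covers-cong : ∀ G {p} τ x (I J : Fin p → Interval) →
  (∀ i (q : Fin (n G)) → InPos (I i) (toℕ q) ⇔ InPos (J i) (toℕ q)) → Covers G τ x I → Covers G τ x J
covers-cong G τ x I J same cover y = ⇔.trans (cover y) (∃-⇔ λ i → same i (τ i y))

pos-model-cong : ∀ G p {τ τ′} → (∀ i y → τ i y ≡ τ′ i y) → PosModel G p τ → PosModel G p τ′
pos-model-cong G p {τ} {τ′} τ≗τ′ model x = I , λ y → ⇔.trans (proj₂ (model x) y) (∃-⇔ (moved y))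
  where
    I = proj₁ (model x)
    moved : ∀ y i → InPos (I i) (toℕ (τ i y)) ⇔ InPos (I i) (toℕ (τ′ i y))
    moved y i = subst (λ w → InPos (I i) (toℕ (τ i y)) ⇔ InPos (I i) (toℕ w)) (τ≗τ′ i y) ⇔.refl

-- An interval with both endpoints truncated at N, stored in Fin (suc N).
IntervalCode : ℕ → Set
IntervalCode N = Fin (suc N) × Fin (suc N)

decode-interval : ∀ {N} → IntervalCode N → Interval
decode-interval (a , b) = toℕ a , toℕ b

truncate : ∀ N → Interval → IntervalCode N
truncate N (a , b) = fromℕ< (s≤s (m⊓n≤n a N)) , fromℕ< (s≤s (m⊓n≤n b N))

InPos-⊓ : ∀ N a b {q} → q < N → InPos (a , b) q ⇔ InPos (a ⊓ N , b ⊓ N) q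
InPos-⊓ N a b {q} q<N = mk⇔ (λ (a≤q , q<b) → ≤-trans (m⊓n≤m a N) a≤q , ⊓-glb q<b q<N)
                            (λ (a⊓N≤q , q<b⊓N) → untruncate (≤-total a N) a⊓N≤q , <-≤-trans q<b⊓N (m⊓n≤m b N))
  where
    untruncate : a ≤ N ⊎ N ≤ a → a ⊓ N ≤ q → a ≤ q
    untruncate (inj₁ a≤N) = subst (_≤ q) (m≤n⇒m⊓n≡m a≤N)
    untruncate (inj₂ N≤a) N≤q = ⊥-elim (<⇒≱ q<N (subst (_≤ q) (m≥n⇒m⊓n≡n N≤a) N≤q))

truncate-InPos : ∀ N J (q : Fin N) → InPos J (toℕ q) ⇔ InPos (decode-interval (truncate N J)) (toℕ q)
truncate-InPos N (a , b) q =
  subst (λ J′ → InPos (a , b) (toℕ q) ⇔ InPos J′ (toℕ q)) (≡.sym (≡.cong₂ _,_ (toℕ-fromℕ< _) (toℕ-fromℕ< _)))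
        (InPos-⊓ N a b (toℕ<n q))

-- Whether N[x] can be covered is decided by trying all truncated intervals.
covers? : ∀ G {p} τ x → Dec (∃ (Covers G {p} τ x))
covers? G {p} τ x =
  map′ decoded encoded (search-Vec (search-× search-Fin search-Fin) p (Covers G τ x ∘ codes) (covers-fixed? ∘ codes))
  where
    codes : Vec (IntervalCode (n G)) p → Fin p → Interval
    codes V i = decode-interval (lookup V i)
    covers-fixed? : ∀ I → Dec (Covers G τ x I)
    covers-fixed? I = all? λ y → ⇔-dec (N? G x y) (any? λ i → InPos? (I i) (toℕ (τ i y)))
    decoded : ∃ (Covers G τ x ∘ codes) → ∃ (Covers G τ x)
    decoded (V , cover) = codes V , cover
    encoded : ∃ (Covers G τ x) → ∃ (Covers G τ x ∘ codes)
    encoded (I , cover) = V , covers-cong G τ x I (codes V) same cover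
      where
        V = tabulate (truncate (n G) ∘ I)
        same : ∀ i q → InPos (I i) (toℕ q) ⇔ InPos (codes V i) (toℕ q)
        same i q = subst (λ c → InPos (I i) (toℕ q) ⇔ InPos (decode-interval c) (toℕ q))
                         (≡.sym (lookup∘tabulate (truncate (n G) ∘ I) i)) (truncate-InPos (n G) (I i) q)

pos-model? : ∀ G p τ → Dec (PosModel G p τ)
pos-model? G p τ = all? (covers? G τ)

-- A permutation of Fin N, stored as the tables of its two directions.
PermCode : ℕ → Set
PermCode N = Vec (Fin N) N × Vec (Fin N) N

MutuallyInverse : ∀ {N} → PermCode N → Set
MutuallyInverse (f , g) = (∀ y → lookup f (lookup g y) ≡ y) × (∀ x → lookup g (lookup f x) ≡ x)

mutually-inverse? : ∀ {N} (c : PermCode N) → Dec (MutuallyInverse c)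
mutually-inverse? (f , g) = all? (λ y → lookup f (lookup g y) ≟ᶠ y) ×-dec all? (λ x → lookup g (lookup f x) ≟ᶠ x)

decode-perm : ∀ {N} (c : PermCode N) → MutuallyInverse c → Permutation′ N
decode-perm (f , g) (fg , gf) = permutation (lookup f) (lookup g) fg gf

encode-perm : ∀ {N} → Permutation′ N → PermCode N
encode-perm σ = tabulate (σ ⟨$⟩ʳ_) , tabulate (σ ⟨$⟩ˡ_)

encode-perm-inverse : ∀ {N} (σ : Permutation′ N) → MutuallyInverse (encode-perm σ)
encode-perm-inverse σ = (λ y → through (σ ⟨$⟩ʳ_) (σ ⟨$⟩ˡ_) y (inverseʳ σ)) , (λ x → through (σ ⟨$⟩ˡ_) (σ ⟨$⟩ʳ_) x (inverseˡ σ))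
  where
    through : ∀ {N} (f g : Fin N → Fin N) y → f (g y) ≡ y → lookup (tabulate f) (lookup (tabulate g) y) ≡ y
    through f g y fg = ≡.trans (lookup∘tabulate f _) (≡.trans (cong f (lookup∘tabulate g y)) fg)

∃-orders? : ∀ {N} p (P : (Fin p → Fin N → Fin N) → Set) → (∀ τ → Dec (P τ)) →
  (∀ {τ τ′} → (∀ i y → τ i y ≡ τ′ i y) → P τ → P τ′) →
  Dec (∃ λ (σ : Fin p → Permutation′ N) → P (λ i → σ i ⟨$⟩ʳ_))
∃-orders? {N} p P P? P-cong = map′ decoded encoded (search-Vec search-code p Q Q?)
  where
    search-code : Searchable (PermCode N)
    search-code = search-× (search-Vec search-Fin N) (search-Vec search-Fin N)
    τ : Vec (PermCode N) p → Fin p → Fin N → Fin N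
    τ V i = lookup (proj₁ (lookup V i))
    Q : Vec (PermCode N) p → Set
    Q V = (∀ i → MutuallyInverse (lookup V i)) × P (τ V)
    Q? : ∀ V → Dec (Q V)
    Q? V = all? (mutually-inverse? ∘ lookup V) ×-dec P? (τ V)
    decoded : ∃ Q → ∃ λ (σ : Fin p → Permutation′ N) → P (λ i → σ i ⟨$⟩ʳ_)
    decoded (V , inverse , PV) = (λ i → decode-perm (lookup V i) (inverse i)) , PV
    encoded : (∃ λ (σ : Fin p → Permutation′ N) → P (λ i → σ i ⟨$⟩ʳ_)) → ∃ Q
    encoded (σ , Pσ) = V , inverse , P-cong same Pσ
      where
        V = tabulate (encode-perm ∘ σ)
        inverse : ∀ i → MutuallyInverse (lookup V i)
        inverse i = subst MutuallyInverse (≡.sym (lookup∘tabulate (encode-perm ∘ σ) i)) (encode-perm-inverse (σ i))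
        same : ∀ i y → σ i ⟨$⟩ʳ y ≡ τ V i y
        same i y = ≡.sym (≡.trans (cong (λ c → lookup (proj₁ c) y) (lookup∘tabulate (encode-perm ∘ σ) i))
                                  (lookup∘tabulate (σ i ⟨$⟩ʳ_) y))

has-lin? : ∀ G p → Dec (HasLin G p)
has-lin? G p = ∃-orders? p (PosModel G p) (pos-model? G p) (pos-model-cong G p)

-- A contiguity model is a line model whose orders all coincide.
has-cont? : ∀ G k → Dec (HasCont G k)
has-cont? G k = map′ (λ (σ , model) → σ zero , model) (λ (σ , model) → (λ _ → σ) , model)
  (∃-orders? 1 (λ τ → PosModel G k (λ _ → τ zero)) (λ τ → pos-model? G k (λ _ → τ zero))
             (λ τ≗τ′ → pos-model-cong G k (λ _ → τ≗τ′ zero)))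

Least : (ℕ → Set) → Set
Least P = ∃ λ c → P c × (∀ j → P j → c ≤ j)

least : ∀ {P : ℕ → Set} → (∀ k → Dec (P k)) → ∃ P → Least P
least {P} P? (w , Pw) with scan (suc w)
  where
    scan : ∀ b → Least P ⊎ (∀ j → j < b → ¬ P j)
    scan zero = inj₂ λ j ()
    scan (suc b) with scan b
    ... | inj₁ found = inj₁ found
    ... | inj₂ none-below with P? b
    ...   | yes Pb = inj₁ (b , Pb , λ j Pj → ≮⇒≥ λ j<b → none-below j j<b Pj)
    ...   | no ¬Pb = inj₂ λ j j≤b → below-or-at (m≤n⇒m<n∨m≡n (s≤s⁻¹ j≤b))
      where
        below-or-at : ∀ {j} → j < b ⊎ j ≡ b → ¬ P j
        below-or-at (inj₁ j<b) = none-below _ j<b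
        below-or-at (inj₂ refl) = ¬Pb
... | inj₁ found = found
... | inj₂ none = ⊥-elim (none w ≤-refl Pw)

-- Every graph has a contiguity model in which N[x] is the union of the
-- one-point intervals [y, y + 1) for y ∈ N[x].
singleton-model : ∀ G → HasCont G (n G)
singleton-model G = id , λ x → point x , λ y → mk⇔ (own-point x y) (λ (i , i≤y , y<) → in-point x y i (N? G x i) i≤y y<)
  where
    -- [i, i + 1) if i ∈ N[x], the empty interval [i, i) otherwise
    point : Fin (n G) → Fin (n G) → Interval
    point x i = toℕ i , ⟦ inN G x i ⟧ + toℕ i
    own-point : ∀ x y → N[ G ]∋ x y → ∃ λ i → InPos (point x i) (toℕ y)
    own-point x y x∼y = y , ≤-refl , subst (λ b → toℕ y < ⟦ b ⟧ + toℕ y) (≡.sym (dec-true (N? G x y) x∼y)) ≤-refl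
    in-point : ∀ x y i (d : Dec (N[ G ]∋ x i)) → toℕ i ≤ toℕ y → toℕ y < ⟦ does d ⟧ + toℕ i → N[ G ]∋ x y
    in-point x y i (yes x∼i) i≤y y≤i = subst (N[ G ]∋ x) (toℕ-injective (≤-antisym i≤y (s≤s⁻¹ y≤i))) x∼i
    in-point x y i (no _) i≤y y<i = ⊥-elim (<⇒≱ y<i i≤y)

contiguity : ∀ G → ∃ (IsCont G)
contiguity G = least (has-cont? G) (n G , singleton-model G)

-- A contiguity model is a line model with all orders equal, so lin ≤ cont.
linearity : ∀ G → ∃ (IsLin G)
linearity G = least (has-lin? G) (n G , (λ _ → proj₁ (singleton-model G)) , proj₂ (singleton-model G))

rook-cont-large : ∀ M h k → HasCont (Rook (suc h)) k → suc (M * 2 * 2) ≤ h → M * 2 < k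
rook-cont-large M h k model large = ≰⇒> λ k≤2M → <⇒≱ h<N (+-cancelʳ-≤ (N * X) N h (begin
  N + N * X            ≡⟨ *-suc N X ⟨
  N * suc X            ≤⟨ *-monoʳ-≤ N large ⟩
  N * h                ≤⟨ cont-lower-bound (Rook (suc h)) k h model separated ⟩
  N * (k * 2) + h      ≤⟨ +-monoˡ-≤ h (*-monoʳ-≤ N (*-monoˡ-≤ 2 k≤2M)) ⟩
  N * X + h            ≡⟨ +-comm (N * X) h ⟩
  h + N * X            ∎))
  where
    open ≤-Reasoning
    N = suc h * suc h
    X = M * 2 * 2
    h<N : h < N
    h<N = m≤m*n (suc h) (suc h)
    separated : ∀ u v → u ≢ v → h ≤ separation (Rook (suc h)) u v
    separated u v u≢v = s≤s⁻¹ (rook-separation (suc h) u v u≢v)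

rook-contiguity rook-linearity : ℕ → ℕ
rook-contiguity h = proj₁ (contiguity (Rook (suc h)))
rook-linearity h = proj₁ (linearity (Rook (suc h)))

theorem2 : Σ (ℕ → Graph) λ G →
    Σ (ℕ → ℕ) λ c → Σ (ℕ → ℕ) λ l →
    (∀ h → IsCont (G (suc h)) (c h) × IsLin (G (suc h)) (l h))
    × (∀ M → ∃ λ H → ∀ h → H ≤ h → M * l h < c h)
theorem2 = Rook , rook-contiguity , rook-linearity
         , (λ h → proj₂ (contiguity (Rook (suc h))) , proj₂ (linearity (Rook (suc h))))
         , λ M → suc (M * 2 * 2) , λ h large → begin-strict
             M * rook-linearity h  ≤⟨ *-monoʳ-≤ M (lin≤2 h) ⟩
             M * 2                 <⟨ rook-cont-large M h (rook-contiguity h) (cont-model h) large ⟩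
             rook-contiguity h     ∎
  where
    open ≤-Reasoning
    lin≤2 : ∀ h → rook-linearity h ≤ 2
    lin≤2 h = proj₂ (proj₂ (linearity (Rook (suc h)))) 2 (rook-orders (suc h) , rook-line-model (suc h))
    cont-model : ∀ h → HasCont (Rook (suc h)) (rook-contiguity h)
    cont-model h = proj₁ (proj₂ (contiguity (Rook (suc h))))
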